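{- Let $q$ be an odd prime power and $m\ge2$ an integer with $m\mid q+1$. For the subgraph of $\mathrm{GP}(q^2,m)$ induced by $\alpha Q$ the following hold. (1) If $m$ is odd, then $\alpha Q_0$ is a clique and $\alpha Q_1,\dots,\alpha Q_{m-1}$ are independent sets; for any $0\le i_1<i_2\le m-1$, all possible edges are present between $\alpha Q_{i_1}$ and $\alpha Q_{i_2}$ if $i_1+i_2\equiv0\pmod m$ and no such edges exist otherwise. In particular $\alpha Q_1\cup\alpha Q_{m-1},\dots,\alpha Q_{\frac{m-1}2}\cup\alpha Q_{\frac{m+1}2}$ induce $\frac{m-1}2$ complete bipartite graphs. (2) If $m$ is even, then $\alpha Q_0$ and $\alpha Q_{m/2}$ are cliques and $\alpha Q_1,\dots,\alpha Q_{\frac m2-1},\alpha Q_{\frac m2+1},\dots,\alpha Q_{m-1}$ are independent sets; for any $0\le i_1<i_2\le m-1$, all possible edges are present between $\alpha Q_{i_1}$ and $\alpha Q_{i_2}$ if $i_1+i_2\equiv0\pmod m$ and no such edges exist otherwise. In particular, if $m>2$, then $\alpha Q_1\cup\alpha Q_{m-1},\dots,\alpha Q_{\frac m2-1}\cup\alpha Q_{\frac m2+1}$ induce $\frac m2-1$ complete bipartite graphs.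
   Context: The generalised Paley graph $\mathrm{GP}(q^2,m)$ has vertex set $\mathbb{F}_{q^2}$, with two distinct vertices $x,y$ adjacent iff $x-y$ is an $m$-th power of an element of $\mathbb{F}_{q^2}^*$. Fix a non-square $d\in\mathbb{F}_q^*$ and $\alpha\in\mathbb{F}_{q^2}$ with $\alpha^2=d$. Fix a primitive element $\beta$ of $\mathbb{F}_{q^2}$, let $\omega=\beta^{q-1}$, $Q=\langle\omega\rangle$, $Q_0=\langle\omega^m\rangle$, and $Q_i=\omega^iQ_0$ for $0\le i\le m-1$; for a set $S$, $\alpha S=\{\alpha s:s\in S\}$. -}

module Defs where

open import Level using (0ℓ)
open import Data.Nat using (ℕ; _∸_; _≤_)
open import Data.Nat.Primality using (Prime)
import Data.Nat as N
open import Data.Nat.Divisibility using (_∣_)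
open import Data.Fin using (Fin)
open import Data.Product using (Σ; ∃; _×_)
open import Relation.Nullary using (¬_)
open import Relation.Binary.PropositionalEquality as ≡ using (_≡_)
open import Algebra.Bundles using (CommutativeRing; Semiring)
open import Function.Bundles using (Bijection)

IsOddPrimePower : ℕ → Set
IsOddPrimePower q = Σ ℕ λ p → Σ ℕ λ k → Prime p × ¬ (p ≡ 2) × 1 ≤ k × q ≡ p Data.Nat.^ k

module FieldDefs (F : CommutativeRing 0ℓ 0ℓ) where
  open CommutativeRing F
  open import Algebra.Definitions.RawSemiring (Semiring.rawSemiring semiring) using (_^_)

  IsField : Set
  IsField = ¬ (0# ≈ 1#) × (∀ x → ¬ (x ≈ 0#) → Σ Carrier λ y → x * y ≈ 1#)

  HasSize : ℕ → Set
  HasSize n = Bijection setoid (≡.setoid (Fin n))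

  -- elements of the subfield F_q of F_{q^2}
  InSubfield : ℕ → Carrier → Set
  InSubfield q x = x ^ q ≈ x

  IsNonSquareInSubfield : ℕ → Carrier → Set
  IsNonSquareInSubfield q d =
    InSubfield q d × ¬ (d ≈ 0#) ×
    ¬ (Σ Carrier λ y → InSubfield q y × y * y ≈ d)

  IsPrimitive : Carrier → Set
  IsPrimitive β = ¬ (β ≈ 0#) × (∀ x → ¬ (x ≈ 0#) → Σ ℕ λ k → x ≈ β ^ k)

  Adj : ℕ → Carrier → Carrier → Set
  Adj m x y = ¬ (x ≈ y) × (Σ Carrier λ z → ¬ (z ≈ 0#) × x - y ≈ z ^ m)

  -- membership in  α Q_i  where Q_i = ω^i ⟨ω^m⟩,  ω = β^(q-1)
  InαQ : ℕ → ℕ → Carrier → Carrier → ℕ → Carrier → Set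
  InαQ q m α β i x = Σ ℕ λ k → x ≈ α * ((ω ^ i) * ((ω ^ m) ^ k))
    where ω = β ^ (q ∸ 1)

  Pred : Set₁
  Pred = Carrier → Set

  IsClique : ℕ → Pred → Set
  IsClique m S = ∀ x y → S x → S y → ¬ (x ≈ y) → Adj m x y

  IsIndependent : ℕ → Pred → Set
  IsIndependent m S = ∀ x y → S x → S y → ¬ Adj m x y

  AllEdgesBetween : ℕ → Pred → Pred → Set
  AllEdgesBetween m S T = ∀ x y → S x → T y → Adj m x y

  NoEdgesBetween : ℕ → Pred → Pred → Set
  NoEdgesBetween m S T = ∀ x y → S x → T y → ¬ Adj m x y

  InducesCompleteBipartite : ℕ → Pred → Pred → Set
  InducesCompleteBipartite m S T =
    IsIndependent m S × IsIndependent m T × AllEdgesBetween m S T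

  EdgesBetweenClasses : ℕ → ℕ → Carrier → Carrier → Set
  EdgesBetweenClasses q m α β = ∀ i₁ i₂ → i₁ N.< i₂ → i₂ N.< m →
    (m ∣ i₁ N.+ i₂ → AllEdgesBetween m (InαQ q m α β i₁) (InαQ q m α β i₂)) ×
    (¬ (m ∣ i₁ N.+ i₂) → NoEdgesBetween m (InαQ q m α β i₁) (InαQ q m α β i₂))

-- Write ω = β^(q−1); its powers u are the (q+1)-th roots of unity, so u^q = u⁻¹. Since α ∉ F_q and
-- α² ∈ F_q we have α^q = −α. Hence for x = α ω^a and y = α ω^b the Frobenius map gives
-- (x − y)^q = −α (ω^(−a) − ω^(−b)) = (x − y) ω^(−(a+b)), i.e. (x − y)^(q−1) ω^(a+b) = 1. Writing
-- x − y = β^e, this says that q² − 1 divides (q − 1)(e + a + b), so m ∣ q + 1 divides e + a + b.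
-- Thus x − y is an m-th power exactly when m ∣ a + b, i.e. when the class indices satisfy
-- i₁ + i₂ ≡ 0 (mod m); cliques, independent sets and complete bipartite pairs are the cases
-- i₁ = i₂ and i₂ = m − i₁ of this criterion.

module Submission where

open import Defs
open import Level using (0ℓ)
import Data.Nat as N
open import Data.Nat using (ℕ)
open import Data.Nat.Divisibility using (_∣_)
open import Data.Product using (_×_)
open import Relation.Nullary using (¬_)
open import Relation.Binary.PropositionalEquality using (_≢_)
open import Algebra.Bundles using (CommutativeRing)

module NatLemmas where
  open import Data.Nat
  open import Data.Nat.Properties
  open import Data.Nat.Divisibility
  open import Data.Nat.DivMod
  open import Data.Nat.Primality using (Prime; euclidsLemma; prime⇒nonTrivial)
  open import Data.Nat.Combinatorics using (_C_; k![n∸k]!∣n!; nCk≡n!/k![n-k]!)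
  open import Data.Nat.Tactic.RingSolver using (solve-∀)
  open import Data.Sum using (inj₁; inj₂)
  open import Relation.Nullary using (¬_; contradiction)
  open import Relation.Binary.PropositionalEquality

  prime∤n! : ∀ {p n} → Prime p → n < p → p ∤ n !
  prime∤n! {n = zero} p-prime _ p∣1 =
    nonTrivial⇒≢1 {{prime⇒nonTrivial p-prime}} (∣1⇒≡1 p∣1)
  prime∤n! {n = suc n} p-prime n<p p∣[1+n]! with euclidsLemma (suc n) (n !) p-prime p∣[1+n]!
  ... | inj₁ p∣1+n = <⇒≱ n<p (∣⇒≤ p∣1+n)
  ... | inj₂ p∣n!  = prime∤n! p-prime (<-trans (n<1+n n) n<p) p∣n!

  nCk*[k!*[n∸k]!]≡n! : ∀ {n k} → k ≤ n → (n C k) * (k ! * (n ∸ k) !) ≡ n !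
  nCk*[k!*[n∸k]!]≡n! {n} {k} k≤n =
    trans (cong (λ c → c * (k ! * (n ∸ k) !)) (nCk≡n!/k![n-k]! k≤n)) (m/n*n≡m (k![n∸k]!∣n! k≤n))
    where instance _ = k !* (n ∸ k) !≢0

  prime∣pCk : ∀ {p k} → Prime p → 0 < k → k < p → p ∣ p C k
  prime∣pCk {p@(suc p-1)} {k} p-prime 0<k k<p
    with euclidsLemma (p C k) (k ! * (p ∸ k) !) p-prime
           (subst (p ∣_) (sym (nCk*[k!*[n∸k]!]≡n! (<⇒≤ k<p))) (m∣m*n (p-1 !)))
  ... | inj₁ p∣pCk = p∣pCk
  ... | inj₂ p∣k!*[p∸k]! with euclidsLemma (k !) ((p ∸ k) !) p-prime p∣k!*[p∸k]!
  ...   | inj₁ p∣k!     = contradiction p∣k! (prime∤n! p-prime k<p)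
  ...   | inj₂ p∣[p∸k]! = contradiction p∣[p∸k]! (prime∤n! p-prime (∸-monoʳ-< 0<k (<⇒≤ k<p)))

  n+n≡n*2 : ∀ n → n + n ≡ n * 2
  n+n≡n*2 = solve-∀

  m∣n+n⇒n+n≡m : ∀ {m n} → 0 < n → n < m → m ∣ n + n → n + n ≡ m
  m∣n+n⇒n+n≡m {m} {n} 0<n _ (divides zero n+n≡0) =
    contradiction n+n≡0 (>⇒≢ (<-≤-trans 0<n (m≤m+n n n)))
  m∣n+n⇒n+n≡m {m} {n} _ _ (divides 1 n+n≡m+0) = trans n+n≡m+0 (+-identityʳ m)
  m∣n+n⇒n+n≡m {m} {n} _ n<m (divides (suc (suc k)) n+n≡m+[m+km]) =
    contradiction (subst (m + m ≤_) (sym n+n≡m+[m+km]) (+-monoʳ-≤ m (m≤m+n m (k * m))))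
                  (<⇒≱ (+-mono-< n<m n<m))

  odd⇒m∤n+n : ∀ {m n} → ¬ (2 ∣ m) → 0 < n → n < m → m ∤ n + n
  odd⇒m∤n+n {m} {n} m-odd 0<n n<m m∣n+n =
    m-odd (divides n (trans (sym (m∣n+n⇒n+n≡m 0<n n<m m∣n+n)) (n+n≡n*2 n)))

  m∣n+n⇒n≡m/2 : ∀ {m n} → 0 < n → n < m → m ∣ n + n → n ≡ m / 2
  m∣n+n⇒n≡m/2 {m} {n} 0<n n<m m∣n+n = begin
    n             ≡⟨ m*n/n≡m n 2 ⟨
    n * 2 / 2     ≡⟨ cong (_/ 2) (n+n≡n*2 n) ⟨
    (n + n) / 2   ≡⟨ cong (_/ 2) (m∣n+n⇒n+n≡m 0<n n<m m∣n+n) ⟩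
    m / 2         ∎
    where open ≡-Reasoning

  2∣m⇒m∣m/2+m/2 : ∀ {m} → 2 ∣ m → m ∣ m / 2 + m / 2
  2∣m⇒m∣m/2+m/2 {m} 2∣m =
    subst (m ∣_) (sym (trans (n+n≡n*2 (m / 2)) (m/n*n≡m 2∣m))) ∣-refl

  m∣[m∸n]+[m∸n]⇒m∣n+n : ∀ {m n} → n ≤ m → m ∣ (m ∸ n) + (m ∸ n) → m ∣ n + n
  m∣[m∸n]+[m∸n]⇒m∣n+n {m} {n} n≤m m∣[m∸n]+[m∸n] =
    ∣m+n∣m⇒∣n (subst (m ∣_) (sym [m∸n+m∸n]+[n+n]≡m+m) (m∣m*n 2))
              m∣[m∸n]+[m∸n]
    where
    regroup : ∀ a b → (a + a) + (b + b) ≡ (a + b) + (a + b)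
    regroup = solve-∀
    [m∸n+m∸n]+[n+n]≡m+m : (m ∸ n + (m ∸ n)) + (n + n) ≡ m * 2
    [m∸n+m∸n]+[n+n]≡m+m =
      trans (regroup (m ∸ n) n) (trans (cong (λ k → k + k) (m∸n+n≡m n≤m)) (n+n≡n*2 m))

  c+c*[1+c]≡c*[[1+c]+1] : ∀ c → c + c * suc c ≡ c * (suc c + 1)
  c+c*[1+c]≡c*[[1+c]+1] = solve-∀

  <∸1⇒< : ∀ {j h} → 1 ≤ j → j ≤ h ∸ 1 → j < h
  <∸1⇒< {h = zero}  1≤j j≤0 = contradiction j≤0 (<⇒≱ 1≤j)
  <∸1⇒< {h = suc h} _   j≤h = s≤s j≤h

  n≤[m∸1]/2⇒n<m : ∀ {m n} → 1 ≤ n → n ≤ (m ∸ 1) / 2 → n < m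
  n≤[m∸1]/2⇒n<m {m} 1≤n n≤[m∸1]/2 = <∸1⇒< 1≤n (≤-trans n≤[m∸1]/2 (m/n≤m (m ∸ 1) 2))

  d∣m+o⇒d∣n+o⇒m%d≡n%d : ∀ {m n o d} .{{_ : NonZero d}} → d ∣ m + o → d ∣ n + o → m % d ≡ n % d
  d∣m+o⇒d∣n+o⇒m%d≡n%d {m} {n} {o} {d} d∣m+o d∣n+o = begin
    m % d                 ≡⟨ %-remove-+ˡ m d∣n+o ⟨
    (n + o + m) % d       ≡⟨ cong (_% d) (swap n o m) ⟩
    (m + o + n) % d       ≡⟨ %-remove-+ˡ n d∣m+o ⟩
    n % d                 ∎
    where
    open ≡-Reasoning
    swap : ∀ a b c → a + b + c ≡ c + b + a
    swap = solve-∀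

  ∣n+k*d⇒∣n : ∀ {d n} k → d ∣ n + k * d → d ∣ n
  ∣n+k*d⇒∣n {d} {n} k d∣n+kd = ∣m+n∣m⇒∣n (subst (d ∣_) (+-comm n (k * d)) d∣n+kd) (n∣m*n k)

open NatLemmas

module CommutativeRingProperties (R : CommutativeRing 0ℓ 0ℓ) where
  open CommutativeRing R
  open import Algebra.Properties.Ring ring using ([y-z]x≈yx-zx)
  open import Algebra.Properties.Semiring.Exp semiring using (_^_; ^-congˡ; ^-congʳ; ^-homo-*; ^-assocʳ)
  open import Data.Nat.DivMod using (_%_; _/_; m≡m%n+[m/n]*n)
  import Data.Nat.Properties as ℕₚ
  open import Relation.Binary.Reasoning.Setoid setoid

  1^n≈1 : ∀ n → 1# ^ n ≈ 1#
  1^n≈1 N.zero    = refl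
  1^n≈1 (N.suc n) = trans (*-identityˡ _) (1^n≈1 n)

  x^n≈1⇒x^k≈x^[k%n] : ∀ {x} n .{{_ : N.NonZero n}} → x ^ n ≈ 1# → ∀ k → x ^ k ≈ x ^ (k % n)
  x^n≈1⇒x^k≈x^[k%n] {x} n x^n≈1 k = begin
    x ^ k                                ≈⟨ ^-congʳ x (m≡m%n+[m/n]*n k n) ⟩
    x ^ (k % n N.+ (k / n) N.* n)        ≈⟨ ^-homo-* x (k % n) _ ⟩
    x ^ (k % n) * x ^ ((k / n) N.* n)    ≈⟨ *-congˡ (^-congʳ x (ℕₚ.*-comm (k / n) n)) ⟩
    x ^ (k % n) * x ^ (n N.* (k / n))    ≈⟨ *-congˡ (^-assocʳ x n (k / n)) ⟨
    x ^ (k % n) * (x ^ n) ^ (k / n)      ≈⟨ *-congˡ (trans (^-congˡ (k / n) x^n≈1) (1^n≈1 (k / n))) ⟩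
    x ^ (k % n) * 1#                     ≈⟨ *-identityʳ _ ⟩
    x ^ (k % n)                          ∎

  [x-y]*[x+y]≈x*x-y*y : ∀ x y → (x - y) * (x + y) ≈ x * x - y * y
  [x-y]*[x+y]≈x*x-y*y x y = begin
    (x - y) * (x + y)                  ≈⟨ distribˡ (x - y) x y ⟩
    (x - y) * x + (x - y) * y          ≈⟨ +-cong ([y-z]x≈yx-zx x x y) ([y-z]x≈yx-zx y x y) ⟩
    (x * x - y * x) + (x * y - y * y)  ≈⟨ +-congˡ (+-congʳ (*-comm x y)) ⟩
    (x * x - y * x) + (y * x - y * y)  ≈⟨ +-assoc (x * x) (- (y * x)) _ ⟩
    x * x + (- (y * x) + (y * x - y * y)) ≈⟨ +-congˡ (+-assoc (- (y * x)) (y * x) _) ⟨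
    x * x + ((- (y * x) + y * x) - y * y) ≈⟨ +-congˡ (+-congʳ (-‿inverseˡ (y * x))) ⟩
    x * x + (0# - y * y)               ≈⟨ +-congˡ (+-identityˡ _) ⟩
    x * x - y * y                      ∎

  x+y≈z⇒x≈z-y : ∀ {x y z} → x + y ≈ z → x ≈ z - y
  x+y≈z⇒x≈z-y {x} {y} {z} x+y≈z = begin
    x              ≈⟨ +-identityʳ x ⟨
    x + 0#         ≈⟨ +-congˡ (-‿inverseʳ y) ⟨
    x + (y - y)    ≈⟨ +-assoc x y (- y) ⟨
    (x + y) - y    ≈⟨ +-congʳ x+y≈z ⟩
    z - y          ∎

module FieldProperties (F : CommutativeRing 0ℓ 0ℓ) (isField : FieldDefs.IsField F) where
  open CommutativeRing F
  open FieldDefs F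
  open CommutativeRingProperties F using ([x-y]*[x+y]≈x*x-y*y)
  open import Algebra.Properties.Ring ring using (+-inverseˡ-unique; x∙y⁻¹≈ε⇒x≈y)
  open import Algebra.Properties.Semiring.Exp semiring using (_^_; ^-congˡ)
  open import Algebra.Properties.CommutativeSemiring.Exp commutativeSemiring using (^-distrib-*)
  open import Data.Product using (_,_; proj₁; proj₂)
  open import Relation.Binary.Reasoning.Setoid setoid

  0≉1 : 0# ≉ 1#
  0≉1 = proj₁ isField

  *-cancelˡ : ∀ {x y z} → x ≉ 0# → x * y ≈ x * z → y ≈ z
  *-cancelˡ {x} {y} {z} x≉0 xy≈xz with proj₂ isField x x≉0
  ... | x⁻¹ , x*x⁻¹≈1 = begin
    y               ≈⟨ *-identityˡ y ⟨
    1# * y          ≈⟨ *-congʳ x⁻¹*x≈1 ⟨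
    (x⁻¹ * x) * y   ≈⟨ *-assoc x⁻¹ x y ⟩
    x⁻¹ * (x * y)   ≈⟨ *-congˡ xy≈xz ⟩
    x⁻¹ * (x * z)   ≈⟨ *-assoc x⁻¹ x z ⟨
    (x⁻¹ * x) * z   ≈⟨ *-congʳ x⁻¹*x≈1 ⟩
    1# * z          ≈⟨ *-identityˡ z ⟩
    z               ∎
    where
    x⁻¹*x≈1 : x⁻¹ * x ≈ 1#
    x⁻¹*x≈1 = trans (*-comm x⁻¹ x) x*x⁻¹≈1

  x*y≈x⇒y≈1 : ∀ {x y} → x ≉ 0# → x * y ≈ x → y ≈ 1#
  x*y≈x⇒y≈1 {x} x≉0 xy≈x = *-cancelˡ x≉0 (trans xy≈x (sym (*-identityʳ x)))

  x*y≈0⇒y≈0 : ∀ {x y} → x ≉ 0# → x * y ≈ 0# → y ≈ 0#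
  x*y≈0⇒y≈0 {x} x≉0 xy≈0 = *-cancelˡ x≉0 (trans xy≈0 (sym (zeroʳ x)))

  x*y≉0 : ∀ {x y} → x ≉ 0# → y ≉ 0# → x * y ≉ 0#
  x*y≉0 x≉0 y≉0 xy≈0 = y≉0 (x*y≈0⇒y≈0 x≉0 xy≈0)

  x^n≉0 : ∀ {x} n → x ≉ 0# → x ^ n ≉ 0#
  x^n≉0 N.zero    _   1≈0 = 0≉1 (sym 1≈0)
  x^n≉0 (N.suc n) x≉0     = x*y≉0 x≉0 (x^n≉0 n x≉0)

  x≉y⇒x-y≉0 : ∀ {x y} → x ≉ y → x - y ≉ 0#
  x≉y⇒x-y≉0 {x} {y} x≉y x-y≈0 = x≉y (x∙y⁻¹≈ε⇒x≈y x y x-y≈0)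

  module _ {q d α} (d-nonsquare : IsNonSquareInSubfield q d) (α*α≈d : α * α ≈ d) where

    sqrt-of-nonsquare≉0 : α ≉ 0#
    sqrt-of-nonsquare≉0 α≈0 = proj₁ (proj₂ d-nonsquare) (begin
      d       ≈⟨ α*α≈d ⟨
      α * α   ≈⟨ *-congʳ α≈0 ⟩
      0# * α  ≈⟨ zeroˡ α ⟩
      0#      ∎)

    -- α^q is a square root of d^q = d, and it is not α itself since α ∉ F_q.
    sqrt-of-nonsquare^q≈- : α ^ q ≈ - α
    sqrt-of-nonsquare^q≈- = +-inverseˡ-unique (α ^ q) α (x*y≈0⇒y≈0 α^q-α≉0 (begin
      (α ^ q - α) * (α ^ q + α)  ≈⟨ [x-y]*[x+y]≈x*x-y*y (α ^ q) α ⟩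
      α ^ q * α ^ q - α * α      ≈⟨ +-congʳ α^q*α^q≈α*α ⟩
      α * α - α * α              ≈⟨ -‿inverseʳ (α * α) ⟩
      0#                         ∎))
      where
      α^q*α^q≈α*α : α ^ q * α ^ q ≈ α * α
      α^q*α^q≈α*α = begin
        α ^ q * α ^ q  ≈⟨ ^-distrib-* α α q ⟨
        (α * α) ^ q    ≈⟨ ^-congˡ q α*α≈d ⟩
        d ^ q          ≈⟨ proj₁ d-nonsquare ⟩
        d              ≈⟨ α*α≈d ⟨
        α * α          ∎
      α^q-α≉0 : α ^ q - α ≉ 0#
      α^q-α≉0 α^q-α≈0 = proj₂ (proj₂ d-nonsquare) (α , x∙y⁻¹≈ε⇒x≈y (α ^ q) α α^q-α≈0 , α*α≈d)

module PrimeCharacteristic (R : CommutativeRing 0ℓ 0ℓ) where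
  open CommutativeRing R
  open CommutativeRingProperties R using (x+y≈z⇒x≈z-y)
  open import Algebra.Properties.Semiring.Exp semiring using (_^_; ^-congˡ; ^-congʳ; ^-assocʳ)
  open import Algebra.Properties.Semiring.Mult semiring
    renaming (_×_ to _·_) using (×1-homo-*; ×-assoc-*; ×-congˡ; ×-congʳ; ×-homo-1)
  open import Algebra.Properties.Semiring.Sum semiring using (sum; sum-init-last; sum-cong-≋; sum-replicate-zero)
  open import Algebra.Properties.CommutativeSemiring.Binomial commutativeSemiring
    using (theorem; binomialExpansion; binomialTerm)
  open import Data.Nat.Combinatorics using (_C_; nCk≡nC[n∸k]; nCn≡1)
  open import Data.Nat.Divisibility using (divides)
  open import Data.Nat.Primality using (Prime)
  import Data.Nat.Properties as ℕₚ
  open import Data.Fin as Fin using (Fin; fromℕ; inject₁; toℕ)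
  open import Data.Fin.Properties using (toℕ-fromℕ; toℕ-inject₁; toℕ<n)
  open import Function using (_∘_)
  import Relation.Binary.PropositionalEquality as ≡
  open import Relation.Binary.Reasoning.Setoid setoid

  p∣n⇒n·x≈0 : ∀ {p n} → p · 1# ≈ 0# → ∀ x → p ∣ n → n · x ≈ 0#
  p∣n⇒n·x≈0 {p} {n} char x (divides t n≡t*p) = begin
    n · x                         ≈⟨ ×-congʳ n (*-identityˡ x) ⟨
    n · (1# * x)                  ≈⟨ ×-assoc-* n 1# x ⟨
    (n · 1#) * x                  ≈⟨ *-congʳ (×-congˡ n≡t*p) ⟩
    ((t N.* p) · 1#) * x          ≈⟨ *-congʳ (×1-homo-* t p) ⟩
    ((t · 1#) * (p · 1#)) * x     ≈⟨ *-congʳ (*-congˡ char) ⟩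
    ((t · 1#) * 0#) * x           ≈⟨ *-congʳ (zeroʳ _) ⟩
    0# * x                        ≈⟨ zeroˡ x ⟩
    0#                            ∎

  sum≈ends : ∀ {k} (f : Fin (N.suc (N.suc k)) → Carrier) →
    (∀ (j : Fin k) → f (Fin.suc (inject₁ j)) ≈ 0#) → sum f ≈ f Fin.zero + f (Fin.suc (fromℕ k))
  sum≈ends {k} f inner≈0 = +-congˡ (begin
    sum (f ∘ Fin.suc)                                    ≈⟨ sum-init-last (f ∘ Fin.suc) ⟩
    sum (λ j → f (Fin.suc (inject₁ j))) + f (Fin.suc (fromℕ k)) ≈⟨ +-congʳ (sum-cong-≋ {k} inner≈0) ⟩
    sum {k} (λ _ → 0#) + f (Fin.suc (fromℕ k))           ≈⟨ +-congʳ (sum-replicate-zero k) ⟩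
    0# + f (Fin.suc (fromℕ k))                           ≈⟨ +-identityˡ _ ⟩
    f (Fin.suc (fromℕ k))                                ∎)

  frobenius : ∀ {p} → Prime p → p · 1# ≈ 0# → ∀ x y → (x + y) ^ p ≈ x ^ p + y ^ p
  frobenius {p@(N.suc (N.suc k))} p-prime char x y = begin
    (x + y) ^ p                                             ≈⟨ theorem p x y ⟩
    binomialExpansion x y p                                 ≈⟨ sum≈ends (binomialTerm x y p) inner≈0 ⟩
    binomialTerm x y p Fin.zero + binomialTerm x y p (Fin.suc (fromℕ (N.suc k))) ≈⟨ +-cong first≈y^p last≈x^p ⟩
    y ^ p + x ^ p                                           ≈⟨ +-comm _ _ ⟩
    x ^ p + y ^ p                                           ∎
    where
    toℕ-last : toℕ (Fin.suc (fromℕ (N.suc k))) ≡.≡ p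
    toℕ-last = ≡.cong N.suc (toℕ-fromℕ (N.suc k))
    p∸toℕ-last≡0 : p N.∸ toℕ (Fin.suc (fromℕ (N.suc k))) ≡.≡ 0
    p∸toℕ-last≡0 = ≡.trans (≡.cong (p N.∸_) toℕ-last) (ℕₚ.n∸n≡0 p)
    first≈y^p : binomialTerm x y p Fin.zero ≈ y ^ p
    first≈y^p = trans (×-congˡ (≡.trans (nCk≡nC[n∸k] {0} {p} N.z≤n) (nCn≡1 p)))
                  (trans (×-homo-1 _) (*-identityˡ _))
    last≈x^p : binomialTerm x y p (Fin.suc (fromℕ (N.suc k))) ≈ x ^ p
    last≈x^p = trans (×-congˡ (≡.trans (≡.cong (p C_) toℕ-last) (nCn≡1 p)))
                 (trans (×-homo-1 _)
                   (trans (*-cong (^-congʳ x toℕ-last) (^-congʳ y p∸toℕ-last≡0)) (*-identityʳ _)))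
    inner≈0 : ∀ (j : Fin (N.suc k)) → binomialTerm x y p (Fin.suc (inject₁ j)) ≈ 0#
    inner≈0 j = p∣n⇒n·x≈0 char _ (prime∣pCk p-prime N.z<s
                  (N.s<s (≡.subst (N._< N.suc k) (≡.sym (toℕ-inject₁ j)) (toℕ<n j))))

  frobenius-^ : ∀ {p} → Prime p → p · 1# ≈ 0# → ∀ f x y →
    (x + y) ^ (p N.^ f) ≈ x ^ (p N.^ f) + y ^ (p N.^ f)
  frobenius-^ p-prime char N.zero    x y = trans (*-identityʳ _) (+-cong (sym (*-identityʳ x)) (sym (*-identityʳ y)))
  frobenius-^ {p} p-prime char (N.suc f) x y = begin
    (x + y) ^ (p N.* p N.^ f)                  ≈⟨ ^-assocʳ (x + y) p (p N.^ f) ⟨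
    ((x + y) ^ p) ^ (p N.^ f)                  ≈⟨ ^-congˡ (p N.^ f) (frobenius p-prime char x y) ⟩
    (x ^ p + y ^ p) ^ (p N.^ f)                ≈⟨ frobenius-^ p-prime char f (x ^ p) (y ^ p) ⟩
    (x ^ p) ^ (p N.^ f) + (y ^ p) ^ (p N.^ f)  ≈⟨ +-cong (^-assocʳ x p _) (^-assocʳ y p _) ⟩
    x ^ (p N.* p N.^ f) + y ^ (p N.* p N.^ f)  ∎

  frobenius-^-sub : ∀ {p} → Prime p → p · 1# ≈ 0# → ∀ f x y →
    (x - y) ^ (p N.^ f) ≈ x ^ (p N.^ f) - y ^ (p N.^ f)
  frobenius-^-sub {p} p-prime char f x y = x+y≈z⇒x≈z-y (begin
    (x - y) ^ (p N.^ f) + y ^ (p N.^ f)  ≈⟨ frobenius-^ p-prime char f (x - y) y ⟨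
    ((x - y) + y) ^ (p N.^ f)            ≈⟨ ^-congˡ (p N.^ f) x-y+y≈x ⟩
    x ^ (p N.^ f)                        ∎)
    where
    x-y+y≈x : (x - y) + y ≈ x
    x-y+y≈x = trans (+-assoc x (- y) y) (trans (+-congˡ (-‿inverseˡ y)) (+-identityʳ x))

module FiniteField (F : CommutativeRing 0ℓ 0ℓ) (isField : FieldDefs.IsField F)
                   {n : ℕ} (size : FieldDefs.HasSize F (N.suc n)) where
  open CommutativeRing F
  open FieldDefs F
  open FieldProperties F isField
  open CommutativeRingProperties F using (x^n≈1⇒x^k≈x^[k%n])
  open PrimeCharacteristic F using (frobenius-^-sub)
  open import Algebra.Properties.Ring ring using (+-identityʳ-unique)
  open import Data.Nat.Primality using (Prime)
  open import Algebra.Properties.Semiring.Exp semiring using (_^_; ^-congʳ)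
  open import Algebra.Properties.Semiring.Mult semiring
    renaming (_×_ to _·_) using (×1-homo-*; ×-congˡ; ×-homo-1)
  import Algebra.Properties.CommutativeMonoid.Sum as MonoidSum
  open import Data.Fin as Fin using (Fin)
  import Data.Fin.Properties as Finₚ
  open import Data.Fin.Permutation using (Permutation; permutation)
  import Data.Nat.Properties as ℕₚ
  open import Data.Nat.DivMod using (_%_; m%n<n)
  open import Data.Nat.Divisibility using (m%n≡0⇒n∣m)
  open import Data.Product using (Σ; _,_; proj₁; proj₂)
  open import Function using (_∘_; id)
  open import Function.Bundles using (Bijection; Surjection)
  open import Relation.Binary.Definitions using (Decidable)
  open import Relation.Nullary using (yes; no; contradiction)
  import Relation.Binary.PropositionalEquality as ≡
  open import Relation.Binary.Reasoning.Setoid setoid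

  private
    module Σ+ = MonoidSum +-commutativeMonoid
    module Π* = MonoidSum *-commutativeMonoid

    to : Carrier → Fin (N.suc n)
    to = Bijection.to size

    from : Fin (N.suc n) → Carrier
    from = Bijection.to⁻ size

    to-from : ∀ i → to (from i) ≡.≡ i
    to-from = Surjection.to∘to⁻ (Bijection.surjection size)

    to-injective : ∀ {x y} → to x ≡.≡ to y → x ≈ y
    to-injective = Bijection.injective size

    to-cong : ∀ {x y} → x ≈ y → to x ≡.≡ to y
    to-cong = Bijection.cong size

    from-to : ∀ x → from (to x) ≈ x
    from-to x = to-injective (to-from (to x))

    permutationOf : (f f⁻¹ : Carrier → Carrier) →
      (∀ {x y} → x ≈ y → f x ≈ f y) → (∀ {x y} → x ≈ y → f⁻¹ x ≈ f⁻¹ y) →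
      (∀ x → f (f⁻¹ x) ≈ x) → (∀ x → f⁻¹ (f x) ≈ x) → Permutation (N.suc n) (N.suc n)
    permutationOf f f⁻¹ f-cong f⁻¹-cong f∘f⁻¹ f⁻¹∘f =
      permutation (to ∘ f ∘ from) (to ∘ f⁻¹ ∘ from) (inverse f-cong f∘f⁻¹) (inverse f⁻¹-cong f⁻¹∘f)
      where
      inverse : ∀ {g h : Carrier → Carrier} → (∀ {x y} → x ≈ y → g x ≈ g y) → (∀ x → g (h x) ≈ x) →
                ∀ i → to (g (from (to (h (from i))))) ≡.≡ i
      inverse g-cong g∘h i = ≡.trans (to-cong (trans (g-cong (from-to _)) (g∘h (from i)))) (to-from i)

  _≟_ : Decidable _≈_
  x ≟ y with to x Fin.≟ to y
  ... | yes tx≡ty = yes (to-injective tx≡ty)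
  ... | no  tx≢ty = no (tx≢ty ∘ to-cong)

  nonzero : Fin n → Carrier
  nonzero j = from (Fin.punchIn (to 0#) j)

  nonzero≉0 : ∀ j → nonzero j ≉ 0#
  nonzero≉0 j nonzero≈0 = Finₚ.punchInᵢ≢i (to 0#) j (≡.trans (≡.sym (to-from _)) (to-cong nonzero≈0))

  nonzero-injective : ∀ {i j} → nonzero i ≈ nonzero j → i ≡.≡ j
  nonzero-injective {i} {j} eq =
    Finₚ.punchIn-injective (to 0#) i j (≡.trans (≡.sym (to-from _)) (≡.trans (to-cong eq) (to-from _)))

  instance
    n-nonZero : N.NonZero n
    n-nonZero = Finₚ.nonZeroIndex (Fin.punchOut {i = to 0#} {j = to 1#} (0≉1 ∘ to-injective))

  -- Translation by x permutes F, so Σ y = Σ (y + x) = Σ y + |F| · x.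
  |F|·x≈0 : ∀ x → N.suc n · x ≈ 0#
  |F|·x≈0 x = +-identityʳ-unique (Σ+.sum from) (N.suc n · x) (sym (begin
    Σ+.sum from                               ≈⟨ Σ+.sum-permute from translation ⟩
    Σ+.sum (λ i → from (to (from i + x)))     ≈⟨ Σ+.sum-cong-≋ {N.suc n} {λ i → from (to (from i + x))}
                                                    {λ i → from i + x} (λ i → from-to _) ⟩
    Σ+.sum (λ i → from i + x)                 ≈⟨ Σ+.∑-distrib-+ from (λ _ → x) ⟩
    Σ+.sum from + Σ+.sum {N.suc n} (λ _ → x)  ≈⟨ +-congˡ (Σ+.sum-replicate (N.suc n)) ⟩
    Σ+.sum from + N.suc n · x                 ∎))
    where
    translation : Permutation (N.suc n) (N.suc n)
    translation = permutationOf (_+ x) (_- x) +-congʳ +-congʳ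
      (λ y → trans (+-assoc y (- x) x) (trans (+-congˡ (-‿inverseˡ x)) (+-identityʳ y)))
      (λ y → trans (+-assoc y x (- x)) (trans (+-congˡ (-‿inverseʳ x)) (+-identityʳ y)))

  characteristic : ∀ {p e} → N.suc n ≡.≡ p N.^ e → p · 1# ≈ 0#
  characteristic {p} {e} |F|≡p^e with (p · 1#) ≟ 0#
  ... | yes p·1≈0 = p·1≈0
  ... | no  p·1≉0 = contradiction [p·1]^e≈0 (x^n≉0 e p·1≉0)
    where
    [p^e]·1≈[p·1]^e : ∀ e → (p N.^ e) · 1# ≈ (p · 1#) ^ e
    [p^e]·1≈[p·1]^e N.zero    = ×-homo-1 1#
    [p^e]·1≈[p·1]^e (N.suc e) = trans (×1-homo-* p (p N.^ e)) (*-congˡ ([p^e]·1≈[p·1]^e e))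
    [p·1]^e≈0 : (p · 1#) ^ e ≈ 0#
    [p·1]^e≈0 = begin
      (p · 1#) ^ e      ≈⟨ [p^e]·1≈[p·1]^e e ⟨
      (p N.^ e) · 1#    ≈⟨ ×-congˡ (≡.sym |F|≡p^e) ⟩
      N.suc n · 1#      ≈⟨ |F|·x≈0 1# ⟩
      0#                ∎

  [x-y]^q≈x^q-y^q : ∀ {p e f q} → Prime p → N.suc n ≡.≡ p N.^ e → q ≡.≡ p N.^ f →
    ∀ x y → (x - y) ^ q ≈ x ^ q - y ^ q
  [x-y]^q≈x^q-y^q {p} {e} {f} p-prime |F|≡p^e ≡.refl = frobenius-^-sub p-prime (characteristic {p} {e} |F|≡p^e) f

  ∏≉0 : ∀ {m} (f : Fin m → Carrier) → (∀ i → f i ≉ 0#) → Π*.sum f ≉ 0#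
  ∏≉0 {N.zero}  f _    1≈0 = 0≉1 (sym 1≈0)
  ∏≉0 {N.suc m} f f≉0      = x*y≉0 (f≉0 Fin.zero) (∏≉0 (f ∘ Fin.suc) (f≉0 ∘ Fin.suc))

  private
    unzero : Carrier → Carrier
    unzero x with x ≟ 0#
    ... | yes _ = 1#
    ... | no  _ = x

    unzero-cong : ∀ {x y} → x ≈ y → unzero x ≈ unzero y
    unzero-cong {x} {y} x≈y with x ≟ 0# | y ≟ 0#
    ... | yes _   | yes _   = refl
    ... | yes x≈0 | no  y≉0 = contradiction (trans (sym x≈y) x≈0) y≉0
    ... | no  x≉0 | yes y≈0 = contradiction (trans x≈y y≈0) x≉0
    ... | no  _   | no  _   = x≈y

    unzero-0 : ∀ {x} → x ≈ 0# → unzero x ≈ 1#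
    unzero-0 {x} x≈0 with x ≟ 0#
    ... | yes _   = refl
    ... | no  x≉0 = contradiction x≈0 x≉0

    unzero-≉0 : ∀ {x} → x ≉ 0# → unzero x ≈ x
    unzero-≉0 {x} x≉0 with x ≟ 0#
    ... | yes x≈0 = contradiction x≈0 x≉0
    ... | no  _   = refl

    -- Replacing 0 by 1 lets a product over all of F stand for the product over F^*.
    ∏unzero≈∏nonzero : (g : Carrier → Carrier) → (∀ {x y} → x ≈ y → g x ≈ g y) →
      g 0# ≈ 0# → (∀ {x} → x ≉ 0# → g x ≉ 0#) → Π*.sum (unzero ∘ g ∘ from) ≈ Π*.sum (g ∘ nonzero)
    ∏unzero≈∏nonzero g g-cong g0≈0 g≉0 = begin
      Π*.sum (unzero ∘ g ∘ from)                                 ≈⟨ Π*.sum-remove {i = to 0#} (unzero ∘ g ∘ from) ⟩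
      unzero (g (from (to 0#))) * Π*.sum (unzero ∘ g ∘ nonzero)  ≈⟨ *-cong unzero[g0]≈1 ∏unzero≈∏ ⟩
      1# * Π*.sum (g ∘ nonzero)                                  ≈⟨ *-identityˡ _ ⟩
      Π*.sum (g ∘ nonzero)                                       ∎
      where
      unzero[g0]≈1 : unzero (g (from (to 0#))) ≈ 1#
      unzero[g0]≈1 = unzero-0 (trans (g-cong (from-to 0#)) g0≈0)
      ∏unzero≈∏ : Π*.sum (unzero ∘ g ∘ nonzero) ≈ Π*.sum (g ∘ nonzero)
      ∏unzero≈∏ = Π*.sum-cong-≋ {n} {unzero ∘ g ∘ nonzero} {g ∘ nonzero} (λ j → unzero-≉0 (g≉0 (nonzero≉0 j)))

  -- Multiplication by x permutes F^*, so Π y = Π (x y) = x^n Π y.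
  x^n≈1 : ∀ {x} → x ≉ 0# → x ^ n ≈ 1#
  x^n≈1 {x} x≉0 = x*y≈x⇒y≈1 (∏≉0 nonzero nonzero≉0) (begin
    Π*.sum nonzero * x ^ n                        ≈⟨ *-comm _ _ ⟩
    x ^ n * Π*.sum nonzero                        ≈⟨ *-congʳ (Π*.sum-replicate n) ⟨
    Π*.sum {n} (λ _ → x) * Π*.sum nonzero         ≈⟨ Π*.∑-distrib-+ (λ _ → x) nonzero ⟨
    Π*.sum ((x *_) ∘ nonzero)                     ≈⟨ ∏unzero≈∏nonzero (x *_) *-congˡ (zeroʳ x) (x*y≉0 x≉0) ⟨
    Π*.sum (unzero ∘ (x *_) ∘ from)               ≈⟨ Π*.sum-cong-≋ {N.suc n} {unzero ∘ (x *_) ∘ from}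
                                                       {unzero ∘ from ∘ to ∘ (x *_) ∘ from}
                                                       (λ i → unzero-cong (sym (from-to _))) ⟩
    Π*.sum (unzero ∘ from ∘ to ∘ (x *_) ∘ from)   ≈⟨ Π*.sum-permute (unzero ∘ from) scaling ⟨
    Π*.sum (unzero ∘ from)                        ≈⟨ ∏unzero≈∏nonzero id id refl id ⟩
    Π*.sum nonzero                                ∎)
    where
    x⁻¹ : Carrier
    x⁻¹ = proj₁ (proj₂ isField x x≉0)
    x*x⁻¹≈1 : x * x⁻¹ ≈ 1#
    x*x⁻¹≈1 = proj₂ (proj₂ isField x x≉0)
    scaling : Permutation (N.suc n) (N.suc n)
    scaling = permutationOf (x *_) (x⁻¹ *_) *-congˡ *-congˡ
      (λ y → trans (sym (*-assoc x x⁻¹ y)) (trans (*-congʳ x*x⁻¹≈1) (*-identityˡ y)))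
      (λ y → trans (sym (*-assoc x⁻¹ x y)) (trans (*-congʳ (trans (*-comm x⁻¹ x) x*x⁻¹≈1)) (*-identityˡ y)))

  primitive⇒n≤period : ∀ {β r} → IsPrimitive β → β ^ N.suc r ≈ 1# → n N.≤ N.suc r
  primitive⇒n≤period {β} {r} (_ , generates) β^[1+r]≈1 = Finₚ.injective⇒≤ exponent-injective
    where
    log : Fin n → ℕ
    log j = proj₁ (generates (nonzero j) (nonzero≉0 j))
    exponent : Fin n → Fin (N.suc r)
    exponent j = Fin.fromℕ< (m%n<n (log j) (N.suc r))
    nonzero≈β^exponent : ∀ j → nonzero j ≈ β ^ Fin.toℕ (exponent j)
    nonzero≈β^exponent j =
      trans (proj₂ (generates (nonzero j) (nonzero≉0 j)))
        (trans (x^n≈1⇒x^k≈x^[k%n] {β} (N.suc r) β^[1+r]≈1 (log j))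
          (^-congʳ β (≡.sym (Finₚ.toℕ-fromℕ< (m%n<n (log j) (N.suc r))))))
    exponent-injective : ∀ {i j} → exponent i ≡.≡ exponent j → i ≡.≡ j
    exponent-injective {i} {j} eq = nonzero-injective
      (trans (nonzero≈β^exponent i) (trans (^-congʳ β (≡.cong Fin.toℕ eq)) (sym (nonzero≈β^exponent j))))

  primitive⇒order : ∀ {β} → IsPrimitive β → ∀ s → β ^ s ≈ 1# → n ∣ s
  primitive⇒order {β} β-primitive s β^s≈1 with s % n in s%n≡r
  ... | N.zero  = m%n≡0⇒n∣m s n s%n≡r
  ... | N.suc r = contradiction (primitive⇒n≤period β-primitive β^[1+r]≈1) (ℕₚ.<⇒≱ 1+r<n)
    where
    β^[1+r]≈1 : β ^ N.suc r ≈ 1#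
    β^[1+r]≈1 = begin
      β ^ N.suc r    ≈⟨ ^-congʳ β s%n≡r ⟨
      β ^ (s % n)    ≈⟨ x^n≈1⇒x^k≈x^[k%n] {β} n (x^n≈1 (proj₁ β-primitive)) s ⟨
      β ^ s          ≈⟨ β^s≈1 ⟩
      1#             ∎
    1+r<n : N.suc r N.< n
    1+r<n = ≡.subst (N._< n) s%n≡r (m%n<n s n)

module GeneralisedPaley (F : CommutativeRing 0ℓ 0ℓ) (isField : FieldDefs.IsField F) where
  open CommutativeRing F
  open FieldDefs F
  open FieldProperties F isField
  open CommutativeRingProperties F using (1^n≈1)
  open import Algebra.Properties.Ring ring
    using (x[y-z]≈xy-xz; [y-z]x≈yx-zx; -‿distribˡ-*; -‿distribʳ-*; ⁻¹-anti-homo‿-)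
  open import Algebra.Properties.Semiring.Exp semiring using (_^_; ^-congˡ; ^-congʳ; ^-homo-*; ^-assocʳ)
  open import Algebra.Properties.CommutativeSemiring.Exp commutativeSemiring using (^-distrib-*)
  import Data.Nat.Properties as ℕₚ
  open import Data.Nat.DivMod using (_%_; _/_; [m+kn]%n≡m%n; m<n⇒m%n≡m; m/n*n≡m)
  open import Data.Nat.Divisibility using (∣-trans; ∣-refl; _∣0; 0∣⇒≡0; *-cancelˡ-∣; ∣m+n∣m⇒∣n; n∣m*n)
  open import Data.Nat.Tactic.RingSolver using (solve-∀)
  open import Data.Product using (Σ; _,_; proj₁; proj₂)
  open import Function using (_∘_)
  open import Relation.Nullary using (contradiction)
  import Relation.Binary.PropositionalEquality as ≡
  open import Relation.Binary.Reasoning.Setoid setoid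

  module Classes (q-1 : ℕ) {{_ : N.NonZero q-1}} (m : ℕ) (m∣q+1 : m ∣ N.suc q-1 N.+ 1)
    (α β : Carrier)
    (frobenius : ∀ x y → (x - y) ^ N.suc q-1 ≈ x ^ N.suc q-1 - y ^ N.suc q-1)
    (α≉0 : α ≉ 0#) (α^q≈-α : α ^ N.suc q-1 ≈ - α)
    (β-primitive : IsPrimitive β)
    {o : ℕ} (o≡[q-1][q+1] : o ≡.≡ q-1 N.* (N.suc q-1 N.+ 1))
    (β^o≈1 : β ^ o ≈ 1#) (β-order : ∀ s → β ^ s ≈ 1# → o ∣ s) where

    q : ℕ
    q = N.suc q-1

    ω : Carrier
    ω = β ^ q-1

    αQ : ℕ → Pred
    αQ = InαQ q m α β

    instance
      m-nonZero : N.NonZero m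
      m-nonZero = N.≢-nonZero λ m≡0 → contradiction (0∣⇒≡0 (≡.subst (_∣ q N.+ 1) m≡0 m∣q+1)) λ ()

    ω^[[q+1]*t]≈1 : ∀ t → ω ^ ((q N.+ 1) N.* t) ≈ 1#
    ω^[[q+1]*t]≈1 t = begin
      ω ^ ((q N.+ 1) N.* t)            ≈⟨ ^-assocʳ β q-1 _ ⟩
      β ^ (q-1 N.* ((q N.+ 1) N.* t))  ≈⟨ ^-congʳ β (ℕₚ.*-assoc q-1 (q N.+ 1) t) ⟨
      β ^ (q-1 N.* (q N.+ 1) N.* t)    ≈⟨ ^-assocʳ β (q-1 N.* (q N.+ 1)) t ⟨
      (β ^ (q-1 N.* (q N.+ 1))) ^ t    ≈⟨ ^-congˡ t (trans (^-congʳ β (≡.sym o≡[q-1][q+1])) β^o≈1) ⟩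
      1# ^ t                           ≈⟨ 1^n≈1 t ⟩
      1#                               ∎

    ω^s≈1⇒m∣s : ∀ s → ω ^ s ≈ 1# → m ∣ s
    ω^s≈1⇒m∣s s ω^s≈1 =
      ∣-trans m∣q+1 (*-cancelˡ-∣ q-1 (≡.subst (_∣ q-1 N.* s) o≡[q-1][q+1]
        (β-order (q-1 N.* s) (trans (sym (^-assocʳ β q-1 s)) ω^s≈1))))

    [ω^a]^q*ω^a≈1 : ∀ a → (ω ^ a) ^ q * ω ^ a ≈ 1#
    [ω^a]^q*ω^a≈1 a = begin
      (ω ^ a) ^ q * ω ^ a      ≈⟨ *-comm _ _ ⟩
      (ω ^ a) ^ N.suc q        ≈⟨ ^-assocʳ ω a (N.suc q) ⟩
      ω ^ (a N.* N.suc q)      ≈⟨ ^-congʳ ω (≡.trans (ℕₚ.*-comm a (N.suc q)) (≡.cong (N._* a) (ℕₚ.+-comm 1 q))) ⟩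
      ω ^ ((q N.+ 1) N.* a)    ≈⟨ ω^[[q+1]*t]≈1 a ⟩
      1#                       ∎

    ω^a≈ω^b⇒m∣a+b*q : ∀ a b → ω ^ a ≈ ω ^ b → m ∣ a N.+ b N.* q
    ω^a≈ω^b⇒m∣a+b*q a b ω^a≈ω^b = ω^s≈1⇒m∣s _ (begin
      ω ^ (a N.+ b N.* q)      ≈⟨ ^-homo-* ω a (b N.* q) ⟩
      ω ^ a * ω ^ (b N.* q)    ≈⟨ *-cong ω^a≈ω^b (sym (^-assocʳ ω b q)) ⟩
      ω ^ b * (ω ^ b) ^ q      ≈⟨ *-comm _ _ ⟩
      (ω ^ b) ^ q * ω ^ b      ≈⟨ [ω^a]^q*ω^a≈1 b ⟩
      1#                       ∎)

    member⇒power : ∀ i {x} → αQ i x → Σ ℕ λ k → x ≈ α * ω ^ (i N.+ k N.* m)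
    member⇒power i (k , x≈) = k , trans x≈ (*-congˡ (begin
      ω ^ i * (ω ^ m) ^ k      ≈⟨ *-congˡ (^-assocʳ ω m k) ⟩
      ω ^ i * ω ^ (m N.* k)    ≈⟨ *-congˡ (^-congʳ ω (ℕₚ.*-comm m k)) ⟩
      ω ^ i * ω ^ (k N.* m)    ≈⟨ ^-homo-* ω i _ ⟨
      ω ^ (i N.+ k N.* m)      ∎))

    -- With u = ω^a, v = ω^b: (α (u − v))^q = −α (u⁻¹ − v⁻¹) = α (u − v) / (u v).
    [x-y]^q*ω^[a+b]≈x-y : ∀ {x y} a b → x ≈ α * ω ^ a → y ≈ α * ω ^ b → (x - y) ^ q * ω ^ (a N.+ b) ≈ x - y
    [x-y]^q*ω^[a+b]≈x-y {x} {y} a b x≈ y≈ = begin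
      (x - y) ^ q * ω ^ (a N.+ b)                 ≈⟨ *-cong (^-congˡ q x-y≈α[u-v]) (^-homo-* ω a b) ⟩
      (α * (u - v)) ^ q * (u * v)                 ≈⟨ *-congʳ (^-distrib-* α (u - v) q) ⟩
      (α ^ q * (u - v) ^ q) * (u * v)             ≈⟨ *-congʳ (*-cong α^q≈-α (frobenius u v)) ⟩
      (- α * (u ^ q - v ^ q)) * (u * v)           ≈⟨ *-assoc (- α) _ _ ⟩
      - α * ((u ^ q - v ^ q) * (u * v))           ≈⟨ *-congˡ ([y-z]x≈yx-zx (u * v) (u ^ q) (v ^ q)) ⟩
      - α * (u ^ q * (u * v) - v ^ q * (u * v))   ≈⟨ *-congˡ (+-cong u^q*uv≈v (-‿cong v^q*uv≈u)) ⟩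
      - α * (v - u)                               ≈⟨ -‿distribˡ-* α (v - u) ⟨
      - (α * (v - u))                             ≈⟨ -‿distribʳ-* α (v - u) ⟩
      α * - (v - u)                               ≈⟨ *-congˡ (⁻¹-anti-homo‿- v u) ⟩
      α * (u - v)                                 ≈⟨ x-y≈α[u-v] ⟨
      x - y                                       ∎
      where
      u v : Carrier
      u = ω ^ a
      v = ω ^ b
      x-y≈α[u-v] : x - y ≈ α * (u - v)
      x-y≈α[u-v] = trans (+-cong x≈ (-‿cong y≈)) (sym (x[y-z]≈xy-xz α u v))
      u^q*uv≈v : u ^ q * (u * v) ≈ v
      u^q*uv≈v = trans (sym (*-assoc (u ^ q) u v)) (trans (*-congʳ ([ω^a]^q*ω^a≈1 a)) (*-identityˡ v))
      v^q*uv≈u : v ^ q * (u * v) ≈ u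
      v^q*uv≈u = trans (*-congˡ (*-comm u v))
                   (trans (sym (*-assoc (v ^ q) v u)) (trans (*-congʳ ([ω^a]^q*ω^a≈1 b)) (*-identityˡ u)))

    [x-y]^[q-1]*ω^[a+b]≈1 : ∀ {x y} a b → x ≉ y → x ≈ α * ω ^ a → y ≈ α * ω ^ b →
      (x - y) ^ q-1 * ω ^ (a N.+ b) ≈ 1#
    [x-y]^[q-1]*ω^[a+b]≈1 {x} {y} a b x≉y x≈ y≈ =
      x*y≈x⇒y≈1 (x≉y⇒x-y≉0 x≉y) (trans (sym (*-assoc (x - y) _ _)) ([x-y]^q*ω^[a+b]≈x-y a b x≈ y≈))

    private
      regroup : ∀ e i₁ k₁ i₂ k₂ m →
        e N.+ ((i₁ N.+ k₁ N.* m) N.+ (i₂ N.+ k₂ N.* m)) ≡.≡ e N.+ (i₁ N.+ i₂) N.+ (k₁ N.+ k₂) N.* m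
      regroup = solve-∀

    m∣log[x-y]+i₁+i₂ : ∀ i₁ i₂ e {x y} → αQ i₁ x → αQ i₂ y → x ≉ y → x - y ≈ β ^ e →
      m ∣ e N.+ (i₁ N.+ i₂)
    m∣log[x-y]+i₁+i₂ i₁ i₂ e {x} {y} x∈αQ y∈αQ x≉y x-y≈β^e
      with member⇒power i₁ x∈αQ | member⇒power i₂ y∈αQ
    ... | k₁ , x≈ | k₂ , y≈ =
      ∣n+k*d⇒∣n (k₁ N.+ k₂) (≡.subst (m ∣_) (regroup e i₁ k₁ i₂ k₂ m) (ω^s≈1⇒m∣s _ (begin
        ω ^ (e N.+ (a N.+ b))              ≈⟨ ^-homo-* ω e (a N.+ b) ⟩
        ω ^ e * ω ^ (a N.+ b)              ≈⟨ *-congʳ ω^e≈[x-y]^[q-1] ⟩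
        (x - y) ^ q-1 * ω ^ (a N.+ b)      ≈⟨ [x-y]^[q-1]*ω^[a+b]≈1 a b x≉y x≈ y≈ ⟩
        1#                                 ∎)))
      where
      a b : ℕ
      a = i₁ N.+ k₁ N.* m
      b = i₂ N.+ k₂ N.* m
      ω^e≈[x-y]^[q-1] : ω ^ e ≈ (x - y) ^ q-1
      ω^e≈[x-y]^[q-1] = begin
        (β ^ q-1) ^ e     ≈⟨ ^-assocʳ β q-1 e ⟩
        β ^ (q-1 N.* e)   ≈⟨ ^-congʳ β (ℕₚ.*-comm q-1 e) ⟩
        β ^ (e N.* q-1)   ≈⟨ ^-assocʳ β e q-1 ⟨
        (β ^ e) ^ q-1     ≈⟨ ^-congˡ q-1 x-y≈β^e ⟨
        (x - y) ^ q-1     ∎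

    adjacent : ∀ i₁ i₂ {x y} → m ∣ i₁ N.+ i₂ → αQ i₁ x → αQ i₂ y → x ≉ y → Adj m x y
    adjacent i₁ i₂ {x} {y} m∣i₁+i₂ x∈αQ y∈αQ x≉y with proj₂ β-primitive (x - y) (x≉y⇒x-y≉0 x≉y)
    ... | e , x-y≈β^e = x≉y , β ^ (e / m) , x^n≉0 (e / m) (proj₁ β-primitive) , (begin
      x - y                 ≈⟨ x-y≈β^e ⟩
      β ^ e                 ≈⟨ ^-congʳ β (m/n*n≡m m∣e) ⟨
      β ^ (e / m N.* m)     ≈⟨ ^-assocʳ β (e / m) m ⟨
      (β ^ (e / m)) ^ m     ∎)
      where
      m∣e : m ∣ e
      m∣e = ∣m+n∣m⇒∣n (≡.subst (m ∣_) (ℕₚ.+-comm e _) (m∣log[x-y]+i₁+i₂ i₁ i₂ e x∈αQ y∈αQ x≉y x-y≈β^e))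
                      m∣i₁+i₂

    nonadjacent : ∀ i₁ i₂ {x y} → ¬ (m ∣ i₁ N.+ i₂) → αQ i₁ x → αQ i₂ y → ¬ Adj m x y
    nonadjacent i₁ i₂ {x} {y} m∤i₁+i₂ x∈αQ y∈αQ (x≉y , w , w≉0 , x-y≈w^m) with proj₂ β-primitive w w≉0
    ... | f , w≈β^f =
      m∤i₁+i₂ (∣m+n∣m⇒∣n (m∣log[x-y]+i₁+i₂ i₁ i₂ (f N.* m) x∈αQ y∈αQ x≉y x-y≈β^[f*m]) (n∣m*n f))
      where
      x-y≈β^[f*m] : x - y ≈ β ^ (f N.* m)
      x-y≈β^[f*m] = trans x-y≈w^m (trans (^-congˡ m w≈β^f) (^-assocʳ β f m))

    classes-disjoint : ∀ {i₁ i₂} {x y} → i₁ N.< m → i₂ N.< m → αQ i₁ x → αQ i₂ y → x ≈ y → i₁ ≡.≡ i₂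
    classes-disjoint {i₁} {i₂} i₁<m i₂<m x∈αQ y∈αQ x≈y with member⇒power i₁ x∈αQ | member⇒power i₂ y∈αQ
    ... | k₁ , x≈ | k₂ , y≈ = ≡.trans (≡.sym (reduce i₁<m k₁)) (≡.trans a%m≡b%m (reduce i₂<m k₂))
      where
      a b : ℕ
      a = i₁ N.+ k₁ N.* m
      b = i₂ N.+ k₂ N.* m
      ω^a≈ω^b : ω ^ a ≈ ω ^ b
      ω^a≈ω^b = *-cancelˡ α≉0 (trans (sym x≈) (trans x≈y y≈))
      a%m≡b%m : a % m ≡.≡ b % m
      a%m≡b%m = d∣m+o⇒d∣n+o⇒m%d≡n%d (ω^a≈ω^b⇒m∣a+b*q a b ω^a≈ω^b) (ω^a≈ω^b⇒m∣a+b*q b b refl)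
      reduce : ∀ {i} → i N.< m → ∀ k → (i N.+ k N.* m) % m ≡.≡ i
      reduce {i} i<m k = ≡.trans ([m+kn]%n≡m%n i k m) (m<n⇒m%n≡m i<m)

    clique : ∀ i → m ∣ i N.+ i → IsClique m (αQ i)
    clique i m∣i+i x y x∈αQ y∈αQ = adjacent i i m∣i+i x∈αQ y∈αQ

    independent : ∀ i → ¬ (m ∣ i N.+ i) → IsIndependent m (αQ i)
    independent i m∤i+i x y x∈αQ y∈αQ = nonadjacent i i m∤i+i x∈αQ y∈αQ

    edgesBetweenClasses : EdgesBetweenClasses q m α β
    edgesBetweenClasses i₁ i₂ i₁<i₂ i₂<m =
      (λ m∣i₁+i₂ x y x∈αQ y∈αQ → adjacent i₁ i₂ m∣i₁+i₂ x∈αQ y∈αQ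
         (ℕₚ.<⇒≢ i₁<i₂ ∘ classes-disjoint (ℕₚ.<-trans i₁<i₂ i₂<m) i₂<m x∈αQ y∈αQ)) ,
      (λ m∤i₁+i₂ x y x∈αQ y∈αQ → nonadjacent i₁ i₂ m∤i₁+i₂ x∈αQ y∈αQ)

    completeBipartite : ∀ {j} → j N.< m → ¬ (m ∣ j N.+ j) → InducesCompleteBipartite m (αQ j) (αQ (m N.∸ j))
    completeBipartite {j} j<m m∤j+j =
      independent j m∤j+j , independent (m N.∸ j) (m∤j+j ∘ m∣[m∸n]+[m∸n]⇒m∣n+n (ℕₚ.<⇒≤ j<m)) , allEdges
      where
      m∣j+[m∸j] : m ∣ j N.+ (m N.∸ j)
      m∣j+[m∸j] = ≡.subst (m ∣_) (≡.sym (ℕₚ.m+[n∸m]≡n (ℕₚ.<⇒≤ j<m))) ∣-refl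
      0<j : 0 N.< j
      0<j = ℕₚ.n≢0⇒n>0 λ j≡0 → m∤j+j (≡.subst (λ t → m ∣ t N.+ t) (≡.sym j≡0) (m ∣0))
      m∸j<m : m N.∸ j N.< m
      m∸j<m = ℕₚ.∸-monoʳ-< 0<j (ℕₚ.<⇒≤ j<m)
      allEdges : AllEdgesBetween m (αQ j) (αQ (m N.∸ j))
      allEdges x y x∈αQ y∈αQ = adjacent j (m N.∸ j) m∣j+[m∸j] x∈αQ y∈αQ λ x≈y →
        m∤j+j (≡.subst (λ t → m ∣ j N.+ t) (≡.sym (classes-disjoint j<m m∸j<m x∈αQ y∈αQ x≈y)) m∣j+[m∸j])

open import Data.Product using (_,_; proj₁)
open import Data.Nat.Divisibility using (_∣0)
open import Data.Nat.DivMod using (m/n≤m)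
import Data.Nat.Properties as ℕₚ
open import Function using (_∘_)
open import Relation.Nullary using (contradiction)
open import Relation.Binary.PropositionalEquality as ≡ using (_≡_; refl)

oddPrimePower≥2 : ∀ {q} → IsOddPrimePower q → 2 N.≤ q
oddPrimePower≥2 (N.suc (N.suc p) , N.suc k , _ , _ , _ , refl) =
  ℕₚ.*-mono-≤ {2} {N.suc (N.suc p)} {1} (N.s≤s (N.s≤s N.z≤n)) (ℕₚ.m^n>0 (N.suc (N.suc p)) k)

theorem4p12 : (q m : ℕ) → IsOddPrimePower q → 2 N.≤ m → m ∣ q N.+ 1 →
    (F : CommutativeRing 0ℓ 0ℓ) →
    let open FieldDefs F in
    IsField → HasSize (q N.* q) →
    (d α β : CommutativeRing.Carrier F) → IsNonSquareInSubfield q d → CommutativeRing._≈_ F (CommutativeRing._*_ F α α) d → IsPrimitive β →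
    (¬ (2 ∣ m) →
      IsClique m (InαQ q m α β 0) ×
      (∀ i → 1 N.≤ i → i N.< m → IsIndependent m (InαQ q m α β i)) ×
      EdgesBetweenClasses q m α β ×
      (∀ j → 1 N.≤ j → j N.≤ (m N.∸ 1) N./ 2 →
        InducesCompleteBipartite m (InαQ q m α β j) (InαQ q m α β (m N.∸ j)))) ×
    (2 ∣ m →
      IsClique m (InαQ q m α β 0) × IsClique m (InαQ q m α β (m N./ 2)) ×
      (∀ i → 1 N.≤ i → i N.< m → i ≢ m N./ 2 → IsIndependent m (InαQ q m α β i)) ×
      EdgesBetweenClasses q m α β ×
      (2 N.< m → ∀ j → 1 N.≤ j → j N.≤ m N./ 2 N.∸ 1 →
        InducesCompleteBipartite m (InαQ q m α β j) (InαQ q m α β (m N.∸ j))))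
theorem4p12 0 _ q-pp = contradiction (oddPrimePower≥2 q-pp) λ ()
theorem4p12 1 _ q-pp = contradiction (oddPrimePower≥2 q-pp) λ { (N.s≤s ()) }
theorem4p12 q@(N.suc q-1@(N.suc _)) m (p , k , p-prime , _ , _ , q≡p^k) _ m∣q+1
            F isField size d α β d-nonsquare α*α≈d β-primitive =
  (λ m-odd →
    clique 0 (m ∣0) , (λ i 1≤i i<m → independent i (odd⇒m∤n+n m-odd 1≤i i<m)) , edgesBetweenClasses ,
    λ j 1≤j j≤[m∸1]/2 → let j<m = n≤[m∸1]/2⇒n<m 1≤j j≤[m∸1]/2 in
      completeBipartite j<m (odd⇒m∤n+n m-odd 1≤j j<m)) ,
  (λ m-even →
    clique 0 (m ∣0) , clique (m N./ 2) (2∣m⇒m∣m/2+m/2 m-even) ,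
    (λ i 1≤i i<m i≢m/2 → independent i (i≢m/2 ∘ m∣n+n⇒n≡m/2 1≤i i<m)) ,
    edgesBetweenClasses ,
    λ _ j 1≤j j≤m/2∸1 → let j<m/2 = <∸1⇒< 1≤j j≤m/2∸1; j<m = ℕₚ.<-≤-trans j<m/2 (m/n≤m m 2) in
      completeBipartite j<m (ℕₚ.<⇒≢ j<m/2 ∘ m∣n+n⇒n≡m/2 1≤j j<m))
  where
  open FieldProperties F isField using (sqrt-of-nonsquare≉0; sqrt-of-nonsquare^q≈-)
  open FiniteField F isField size using ([x-y]^q≈x^q-y^q; x^n≈1; primitive⇒order)
  |F|≡p^[k+k] : q N.* q ≡ p N.^ (k N.+ k)
  |F|≡p^[k+k] = ≡.trans (≡.cong₂ N._*_ q≡p^k q≡p^k) (≡.sym (ℕₚ.^-distribˡ-+-* p k k))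
  open GeneralisedPaley.Classes F isField q-1 m m∣q+1 α β
    ([x-y]^q≈x^q-y^q {e = k N.+ k} {f = k} p-prime |F|≡p^[k+k] q≡p^k)
    (sqrt-of-nonsquare≉0 {q} d-nonsquare α*α≈d) (sqrt-of-nonsquare^q≈- {q} d-nonsquare α*α≈d)
    β-primitive (c+c*[1+c]≡c*[[1+c]+1] q-1) (x^n≈1 (proj₁ β-primitive)) (primitive⇒order β-primitive)
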